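{- Let $n$ be a positive integer and let $f:\mathbb{Z}/n\mathbb{Z}\to\mathbb{Z}/n\mathbb{Z}$ be any function. Then $f$ has a linear representation: there exist a positive integer $m$, a constant $a\in\mathbb{Z}/m\mathbb{Z}$, and an injective function $j:\mathbb{Z}/n\mathbb{Z}\to\mathbb{Z}/m\mathbb{Z}$ such that for all $i\in\mathbb{Z}/n\mathbb{Z}$, $$j(f(i)) = a\cdot j(i)\quad\text{in } \mathbb{Z}/m\mathbb{Z}.$$
   Context: The paper identifies a finite set of size $n$ with $\mathbb{Z}/n\mathbb{Z}=\{0,1,\ldots,n-1\}$; "finite function" means a function from such a set to itself. -}

module Defs where

open import Data.Nat using (ℕ; suc; _*_; _%_)
open import Data.Nat.DivMod using (m%n<n)
open import Data.Fin using (Fin; toℕ; fromℕ<)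

-- Multiplication in ℤ/mℤ, with ℤ/mℤ identified with Fin m = {0,…,m-1}
-- (m positive, written suc k): x ·ₘ y = (x * y) mod m.
_·_ : ∀ {k} → Fin (suc k) → Fin (suc k) → Fin (suc k)
_·_ {k} x y = fromℕ< (m%n<n (toℕ x * toℕ y) (suc k))

{-# OPTIONS --safe #-}
-- Choose P ≥ 1 with f^(2P) = f^P (pigeonhole on each orbit) and the base B = n + 2, larger
-- than every digit 0, …, n. Encode x by the base-B fraction 0.d₀d₁d₂…, where dₖ = f^k(x).
-- Its digits repeat with period P from position P on, so it equals e(x)/M for
-- M = (B^P − 1)·B^P and an integer e(x) < M. Multiplying by B shifts the digit string,
-- turning the fraction of x into d₀ plus the fraction of f(x); hence B·e(x) ≡ e(f(x)) mod M.
-- Finally e is injective because its leading digit d₀ is x itself.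
module Submission where

open import Defs
open import Data.Nat using (ℕ; suc)
open import Data.Fin using (Fin)
open import Data.Product using (Σ; _×_)
open import Function.Definitions using (Injective)
open import Relation.Binary.PropositionalEquality using (_≡_)

open import Data.Nat using (zero; _+_; _*_; _∸_; _^_; _≤_; _<_; _/_; _%_; _!; pred; NonZero; >-nonZero; z<s; s≤s; s≤s⁻¹)
open import Data.Nat.Properties
open import Data.Nat.DivMod
open import Data.Nat.Divisibility using (_∣_; divides; ∣-trans; m≤n⇒m!∣n!; m∣m*n; n∣m*n)
open import Data.Nat.Tactic.RingSolver using (solve-∀)
open import Data.Fin using (zero; toℕ; fromℕ<)
open import Data.Fin.Properties using (pigeonhole; toℕ<n; toℕ-injective; toℕ-fromℕ<; fromℕ<-cong)
open import Data.Product using (_,_; proj₁; proj₂; ∃-syntax; ∃₂)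
open import Function.Base using (_∘_)
open import Relation.Nullary using (contradiction)
open import Relation.Binary.PropositionalEquality using (refl; sym; trans; cong; cong₂; subst; module ≡-Reasoning)

numeral : ℕ → (ℕ → ℕ) → ℕ → ℕ
numeral B s zero    = 0
numeral B s (suc n) = B * numeral B s n + s n

numeral-shift : ∀ B s n → B * numeral B s n + s n ≡ numeral B (s ∘ suc) n + s 0 * B ^ n
numeral-shift B s zero    = cong₂ _+_ (*-zeroʳ B) (sym (*-identityʳ (s 0)))
numeral-shift B s (suc n) = begin
  B * (B * numeral B s n + s n) + s (suc n)
    ≡⟨ cong (λ v → B * v + s (suc n)) (numeral-shift B s n) ⟩
  B * (numeral B (s ∘ suc) n + s 0 * B ^ n) + s (suc n)
    ≡⟨ distribute B (numeral B (s ∘ suc) n) (s 0) (B ^ n) (s (suc n)) ⟩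
  (B * numeral B (s ∘ suc) n + s (suc n)) + s 0 * (B * B ^ n) ∎
  where
  open ≡-Reasoning
  distribute : ∀ b v d p w → b * (v + d * p) + w ≡ (b * v + w) + d * (b * p)
  distribute = solve-∀

numeral-head : ∀ B s n → numeral B s (suc n) ≡ s 0 * B ^ n + numeral B (s ∘ suc) n
numeral-head B s n = trans (numeral-shift B s n) (+-comm _ (s 0 * B ^ n))

numeral-< : ∀ {B} s → (∀ k → s k < B) → ∀ n → numeral B s n < B ^ n
numeral-< s s<B zero    = z<s
numeral-< {B} s s<B (suc n) = begin-strict
  B * numeral B s n + s n  <⟨ +-monoʳ-< (B * numeral B s n) (s<B n) ⟩
  B * numeral B s n + B    ≡⟨ trans (+-comm _ B) (sym (*-suc B _)) ⟩
  B * suc (numeral B s n)  ≤⟨ *-monoʳ-≤ B (numeral-< s s<B n) ⟩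
  B * B ^ n                ∎
  where open ≤-Reasoning

numeral-<-pred : ∀ {B} s → (∀ k → suc (s k) < B) → ∀ n → numeral B s (suc n) < pred (B ^ suc n)
numeral-<-pred {B} s s+1<B n = pred-mono-≤ (begin-strict
  suc (B * numeral B s n + s n)        ≡⟨ +-suc _ (s n) ⟨
  B * numeral B s n + suc (s n)        <⟨ +-monoʳ-< (B * numeral B s n) (s+1<B n) ⟩
  B * numeral B s n + B                ≡⟨ trans (+-comm _ B) (sym (*-suc B _)) ⟩
  B * suc (numeral B s n)              ≤⟨ *-monoʳ-≤ B (numeral-< s (<⇒≤ ∘ s+1<B) n) ⟩
  B * B ^ n                            ∎)
  where open ≤-Reasoning

[m*n+o]/n≡m : ∀ m {n o} .{{_ : NonZero n}} → o < n → (m * n + o) / n ≡ m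
[m*n+o]/n≡m m {n} {o} o<n = begin
  (m * n + o) / n    ≡⟨ +-distrib-/-∣ˡ o (n∣m*n m) ⟩
  m * n / n + o / n  ≡⟨ cong₂ _+_ (m*n/n≡m m n) (m<n⇒m/n≡0 o<n) ⟩
  m + 0              ≡⟨ +-identityʳ m ⟩
  m                  ∎
  where open ≡-Reasoning

numeral-/ : ∀ {B} s → (∀ k → s k < B) → ∀ n .{{_ : NonZero (B ^ n)}} → numeral B s (suc n) / B ^ n ≡ s 0
numeral-/ {B} s s<B n = trans (cong (_/ B ^ n) (numeral-head B s n))
  ([m*n+o]/n≡m (s 0) (numeral-< (s ∘ suc) (s<B ∘ suc) n))

module PeriodicExpansion (b P′ : ℕ) where

  B P Q M : ℕ
  B = suc (suc b)
  P = suc P′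
  Q = pred (B ^ P)
  M = Q * B ^ P

  instance
    B^P′-nonZero : NonZero (B ^ P′)
    B^P′-nonZero = m^n≢0 B P′

    Q-nonZero : NonZero Q
    Q-nonZero = >-nonZero (<-≤-trans z<s (pred-mono-≤ (m≤m*n B (B ^ P′))))

  -- If the digits s repeat with period P from position P on, then numerator s / M is the
  -- base-B fraction 0.s₀s₁s₂…, since 1/M = (1/(B^P − 1)) / B^P.
  numerator : (ℕ → ℕ) → ℕ
  numerator s = Q * numeral B s P + numeral B (λ k → s (k + P)) P

  -- Both sides are raised by s P * B ^ P, which keeps the computation free of subtraction.
  numerator-shift : ∀ s → s (P + P) ≡ s P → B * numerator s ≡ numerator (s ∘ suc) + s 0 * M
  numerator-shift s periodic = +-cancelʳ-≡ (s P * B ^ P) _ _ (begin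
    B * (Q * A + C) + s P * B ^ P                     ≡⟨ cong (λ y → B * (Q * A + C) + s P * y) Q+1 ⟨
    B * (Q * A + C) + s P * suc Q                     ≡⟨ collect B Q A C (s P) ⟩
    Q * (B * A + s P) + (B * C + s P)                 ≡⟨ cong₂ (λ u v → Q * u + v) (numeral-shift B s P) shiftC ⟩
    Q * (A′ + s 0 * B ^ P) + (C′ + s P * B ^ P)       ≡⟨ expand Q A′ (s 0) (B ^ P) C′ (s P) ⟩
    (Q * A′ + C′) + s 0 * (Q * B ^ P) + s P * B ^ P   ∎)
    where
    open ≡-Reasoning
    t : ℕ → ℕ
    t k = s (k + P)
    A C A′ C′ : ℕ
    A  = numeral B s P
    C  = numeral B t P
    A′ = numeral B (s ∘ suc) P
    C′ = numeral B (t ∘ suc) P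
    Q+1 : suc Q ≡ B ^ P
    Q+1 = suc-pred (B ^ P) {{m^n≢0 B P}}
    shiftC : B * C + s P ≡ C′ + s P * B ^ P
    shiftC = subst (λ d → B * C + d ≡ C′ + s P * B ^ P) periodic (numeral-shift B t P)
    collect : ∀ x q a c d → x * (q * a + c) + d * suc q ≡ q * (x * a + d) + (x * c + d)
    collect = solve-∀
    expand : ∀ q a d x c e → q * (a + d * x) + (c + e * x) ≡ (q * a + c) + d * (q * x) + e * x
    expand = solve-∀

  module _ (s : ℕ → ℕ) (s≤b : ∀ k → s k ≤ b) where

    private
      s<B : ∀ k → s k < B
      s<B k = <⇒≤ (s≤s (s≤s (s≤b k)))

      periodic-part-< : numeral B (λ k → s (k + P)) P < Q
      periodic-part-< = numeral-<-pred _ (λ k → s≤s (s≤s (s≤b (k + P)))) P′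

    numerator-< : numerator s < M
    numerator-< = begin-strict
      Q * numeral B s P + numeral B (λ k → s (k + P)) P  <⟨ +-monoʳ-< _ periodic-part-< ⟩
      Q * numeral B s P + Q                              ≡⟨ trans (+-comm _ Q) (sym (*-suc Q _)) ⟩
      Q * suc (numeral B s P)                            ≤⟨ *-monoʳ-≤ Q (numeral-< s s<B P) ⟩
      Q * B ^ P                                          ∎
      where open ≤-Reasoning

    numerator-/ : numerator s / Q / B ^ P′ ≡ s 0
    numerator-/ = begin
      (Q * numeral B s P + numeral B (λ k → s (k + P)) P) / Q / B ^ P′
        ≡⟨ cong (λ a → (a + numeral B (λ k → s (k + P)) P) / Q / B ^ P′) (*-comm Q _) ⟩
      (numeral B s P * Q + numeral B (λ k → s (k + P)) P) / Q / B ^ P′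
        ≡⟨ cong (_/ B ^ P′) ([m*n+o]/n≡m (numeral B s P) periodic-part-<) ⟩
      numeral B s P / B ^ P′
        ≡⟨ numeral-/ s s<B P′ ⟩
      s 0 ∎
      where open ≡-Reasoning

-- Iterating on the argument side makes k ↦ iterate f k (f x) definitionally the shift of k ↦ iterate f k x.
iterate : ∀ {A : Set} → (A → A) → ℕ → A → A
iterate f zero    x = x
iterate f (suc k) x = iterate f k (f x)

module _ {A : Set} (f : A → A) where

  iterate-+ : ∀ m n x → iterate f (m + n) x ≡ iterate f n (iterate f m x)
  iterate-+ zero    n x = refl
  iterate-+ (suc m) n x = iterate-+ m n (f x)

  iterate-comm : ∀ m n x → iterate f m (iterate f n x) ≡ iterate f n (iterate f m x)
  iterate-comm m n x = begin
    iterate f m (iterate f n x)  ≡⟨ iterate-+ n m x ⟨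
    iterate f (n + m) x          ≡⟨ cong (λ k → iterate f k x) (+-comm n m) ⟩
    iterate f (m + n) x          ≡⟨ iterate-+ m n x ⟩
    iterate f n (iterate f m x)  ∎
    where open ≡-Reasoning

  iterate-periodic : ∀ {d m y} → iterate f d y ≡ y → d ∣ m → iterate f m y ≡ y
  iterate-periodic {d} {y = y} fixed (divides q refl) = multiple q
    where
    multiple : ∀ q → iterate f (q * d) y ≡ y
    multiple zero    = refl
    multiple (suc q) = trans (iterate-+ d (q * d) y) (trans (cong (iterate f (q * d)) fixed) (multiple q))

  iterate-idempotent : ∀ {i d P x} → iterate f d (iterate f i x) ≡ iterate f i x → i ≤ P → d ∣ P →
                       iterate f (P + P) x ≡ iterate f P x
  iterate-idempotent {i} {d} {P} {x} cycle i≤P d∣P = begin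
    iterate f (P + P) x          ≡⟨ iterate-+ P P x ⟩
    iterate f P (iterate f P x)  ≡⟨ cong (iterate f P) enter ⟩
    iterate f P (iterate f t y)  ≡⟨ iterate-comm P t y ⟩
    iterate f t (iterate f P y)  ≡⟨ cong (iterate f t) (iterate-periodic cycle d∣P) ⟩
    iterate f t y                ≡⟨ enter ⟨
    iterate f P x                ∎
    where
    open ≡-Reasoning
    t : ℕ
    t = P ∸ i
    y : A
    y = iterate f i x
    enter : iterate f P x ≡ iterate f t y
    enter = trans (cong (λ k → iterate f k x) (sym (m+[n∸m]≡n i≤P))) (iterate-+ i t x)

m≤n⇒m∣n! : ∀ {m n} → 0 < m → m ≤ n → m ∣ n !
m≤n⇒m∣n! {suc m} _ m≤n = ∣-trans (m∣m*n (m !)) (m≤n⇒m!∣n! m≤n)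

module _ {n : ℕ} (f : Fin (suc n) → Fin (suc n)) where

  private
    N : ℕ
    N = suc n

  orbit-returns : ∀ x → ∃₂ λ i j → i < j × j ≤ N × iterate f i x ≡ iterate f j x
  orbit-returns x with pigeonhole (n<1+n N) (λ k → iterate f (toℕ k) x)
  ... | i , j , i<j , same = toℕ i , toℕ j , i<j , s≤s⁻¹ (toℕ<n j) , same

  iterate-factorial-idempotent : ∀ x → iterate f (N ! * N + N ! * N) x ≡ iterate f (N ! * N) x
  iterate-factorial-idempotent x with orbit-returns x
  ... | i , j , i<j , j≤N , same = iterate-idempotent f cycle i≤P d∣P
    where
    d : ℕ
    d = j ∸ i
    cycle : iterate f d (iterate f i x) ≡ iterate f i x
    cycle = trans (sym (iterate-+ f i d x))
                  (trans (cong (λ k → iterate f k x) (m+[n∸m]≡n (<⇒≤ i<j))) (sym same))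
    i≤P : i ≤ N ! * N
    i≤P = ≤-trans (<⇒≤ (<-≤-trans i<j j≤N)) (m≤n*m N (N !) {{N !≢0}})
    d∣P : d ∣ N ! * N
    d∣P = ∣-trans (m≤n⇒m∣n! (m<n⇒0<n∸m i<j) (≤-trans (m∸n≤m j i) j≤N)) (m∣m*n N)

  positive-idempotent-iterate : ∃[ P′ ] ∀ x → iterate f (suc P′ + suc P′) x ≡ iterate f (suc P′) x
  positive-idempotent-iterate =
    pred P , subst (λ p → ∀ x → iterate f (p + p) x ≡ iterate f p x) (sym (suc-pred P)) iterate-factorial-idempotent
    where
    P : ℕ
    P = N ! * N
    instance
      P-nonZero : NonZero P
      P-nonZero = m*n≢0 (N !) N {{N !≢0}}

LinearRepresentation : ∀ {n} → (Fin (suc n) → Fin (suc n)) → Set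
LinearRepresentation {n} f =
  Σ ℕ λ k → Σ (Fin (suc k)) λ a → Σ (Fin (suc n) → Fin (suc k)) λ j →
    Injective _≡_ _≡_ j × (∀ i → j (f i) ≡ a · j i)

linearRepresentation : ∀ {n} (f : Fin (suc n) → Fin (suc n)) (M a : ℕ) (e : Fin (suc n) → ℕ) →
                       (∀ x → e x < M) → Injective _≡_ _≡_ e →
                       (∀ x → ∃[ c ] a * e x ≡ e (f x) + c * M) → LinearRepresentation f
linearRepresentation f zero    a e e<M _     _     = contradiction (e<M zero) n≮0
linearRepresentation {n} f (suc k) a e e<M e-inj e-lin = k , â , j , j-injective , j-linear
  where
  â : Fin (suc k)
  â = fromℕ< (m%n<n a (suc k))
  j : Fin (suc n) → Fin (suc k)
  j x = fromℕ< (e<M x)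
  toℕ-j : ∀ x → toℕ (j x) ≡ e x
  toℕ-j x = toℕ-fromℕ< (e<M x)
  j-injective : Injective _≡_ _≡_ j
  j-injective {x} {y} jx≡jy = e-inj (trans (sym (toℕ-j x)) (trans (cong toℕ jx≡jy) (toℕ-j y)))
  j-linear : ∀ i → j (f i) ≡ â · j i
  j-linear i with e-lin i
  ... | c , ae≡ = fromℕ<-cong _ _ (begin
    e (f i)                        ≡⟨ m<n⇒m%n≡m (e<M (f i)) ⟨
    e (f i) % suc k                ≡⟨ [m+kn]%n≡m%n (e (f i)) c (suc k) ⟨
    (e (f i) + c * suc k) % suc k  ≡⟨ cong (_% suc k) ae≡ ⟨
    (a * e i) % suc k              ≡⟨ %-distribˡ-* a (e i) (suc k) ⟩
    (a % suc k * (e i % suc k)) % suc k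
      ≡⟨ cong₂ (λ p r → (p * r) % suc k) (toℕ-fromℕ< (m%n<n a (suc k))) (trans (toℕ-j i) (sym (m<n⇒m%n≡m (e<M i)))) ⟨
    (toℕ â * toℕ (j i)) % suc k    ∎) _ _
    where open ≡-Reasoning

mainTheorem1 : (n : ℕ) → (f : Fin (suc n) → Fin (suc n)) →
    Σ ℕ λ k → Σ (Fin (suc k)) λ a → Σ (Fin (suc n) → Fin (suc k)) λ j →
      Injective _≡_ _≡_ j × (∀ i → j (f i) ≡ a · j i)
mainTheorem1 n f = linearRepresentation f M B e (λ x → numerator-< (digits x) (digits≤n x)) e-injective e-linear
  where
  P′ : ℕ
  P′ = proj₁ (positive-idempotent-iterate f)
  open PeriodicExpansion n P′
  digits : Fin (suc n) → ℕ → ℕ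
  digits x k = toℕ (iterate f k x)
  digits≤n : ∀ x k → digits x k ≤ n
  digits≤n x k = s≤s⁻¹ (toℕ<n (iterate f k x))
  e : Fin (suc n) → ℕ
  e x = numerator (digits x)
  e-injective : Injective _≡_ _≡_ e
  e-injective {x} {y} ex≡ey = toℕ-injective (begin
    toℕ x             ≡⟨ numerator-/ (digits x) (digits≤n x) ⟨
    e x / Q / B ^ P′  ≡⟨ cong (λ r → r / Q / B ^ P′) ex≡ey ⟩
    e y / Q / B ^ P′  ≡⟨ numerator-/ (digits y) (digits≤n y) ⟩
    toℕ y             ∎)
    where open ≡-Reasoning
  e-linear : ∀ x → ∃[ c ] B * e x ≡ e (f x) + c * M
  e-linear x = toℕ x , numerator-shift (digits x) (cong toℕ (proj₂ (positive-idempotent-iterate f) x))
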